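{- A block filter $\mathcal{F}$ on $E$ is full if and only if for every $A\subseteq E\setminus\{0\}$ there is $X\in E^{[\infty]}$ with $\langle X\rangle\in\mathcal{F}$ such that either $\langle X\rangle\cap A=\emptyset$ or $A$ is asymptotic below $\langle X\rangle$, i.e., $V\cap A\neq\emptyset$ for every infinite-dimensional subspace $V\subseteq\langle X\rangle\cup\{0\}$.
   Context: $E$ is a countably infinite-dimensional vector space over a countable field $F$ with fixed basis $(e_n)$; $\mathrm{supp}(v)$ for nonzero $v$ is the set of $i$ with $e_i$ having nonzero coefficient in $v$. A block sequence is a sequence $(x_n)$ of nonzero vectors with $\max\mathrm{supp}(x_n)<\min\mathrm{supp}(x_{n+1})$; $E^{[\infty]}$ the set of infinite block sequences; $\langle X\rangle$ the span of $X$ with $0$ removed. A filter on $E$ is a proper filter of subsets of $E\setminus\{0\}$ containing the nonzero parts of all finite-codimensional subspaces; a block filter has a base of sets $\langle X\rangle$, $X\in E^{[\infty]}$. For a block filter $\mathcal{F}$, $D\subseteq E$ is $\mathcal{F}$-dense if for every $\langle X\rangle\in\mathcal{F}$ there is an infinite-dimensional subspace $V\subseteq\langle X\rangle\cup\{0\}$ with $V\setminus\{0\}\subseteq D$; $\mathcal{F}$ is full if every $\mathcal{F}$-dense set $D$ belongs to $\mathcal{F}$. -}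

module Defs where

open import Level using (0ℓ)
open import Algebra.Bundles using (CommutativeRing)
open import Data.Nat as ℕ using (ℕ; zero; suc; _<_)
open import Data.Fin using (Fin; toℕ)
import Data.Fin as Fin
open import Data.Empty using (⊥)
open import Data.List using (List; []; _∷_)
open import Data.Bool using (Bool; true; false; not; T)
open import Data.Product using (Σ; ∃; ∃-syntax; _×_; _,_; proj₁)
open import Data.Sum using (_⊎_)
open import Relation.Nullary using (¬_; Dec; yes; no; does)
open import Relation.Binary.PropositionalEquality using (_≡_; cong)
open import Function.Bundles using (_↣_; Injection)
open import Relation.Unary using (Pred; _⊆_)

IsField : CommutativeRing 0ℓ 0ℓ → Set
IsField R = ¬ (1# ≈ 0#) × (∀ x → ¬ (x ≈ 0#) → ∃[ y ] (x * y ≈ 1#))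
  where open CommutativeRing R

-- The space E = ⊕_{n∈ℕ} F e_n over a field F (given as a commutative ring R
-- whose equality is propositional, and countable via an injection into ℕ).
module Space (R : CommutativeRing 0ℓ 0ℓ)
             (≈⇒≡ : ∀ {x y} → CommutativeRing._≈_ R x y → x ≡ y)
             (enc : CommutativeRing.Carrier R ↣ ℕ) where

  open CommutativeRing R using (Carrier; _+_; _*_; 0#)

  K : Set
  K = Carrier

  _≟K_ : (x y : K) → Dec (x ≡ y)
  x ≟K y with Injection.to enc x ℕ.≟ Injection.to enc y
  ... | yes p = yes (Injection.injective enc p)
  ... | no ¬p = no (λ e → ¬p (cong (Injection.to enc) e))

  isZero : K → Bool
  isZero x = does (x ≟K 0#)

  -- a coefficient list is the canonical representation of a nonzero vector
  -- iff it is nonempty and its last entry is nonzero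
  lastNZ : List K → Bool
  lastNZ []           = false
  lastNZ (x ∷ [])     = not (isZero x)
  lastNZ (x ∷ y ∷ l)  = lastNZ (y ∷ l)

  -- E⁺ = E ∖ {0}: nonzero vectors, v = Σ_i (l !! i) e_i, canonically represented
  E⁺ : Set
  E⁺ = Σ (List K) (λ l → T (lastNZ l))

  coeffL : List K → ℕ → K
  coeffL []      _       = 0#
  coeffL (x ∷ l) zero    = x
  coeffL (x ∷ l) (suc i) = coeffL l i

  coeff : E⁺ → ℕ → K
  coeff v = coeffL (proj₁ v)

  supp : E⁺ → ℕ → Set
  supp v i = ¬ (coeff v i ≡ 0#)

  ∑ : (n : ℕ) → (Fin n → K) → K
  ∑ zero    f = 0#
  ∑ (suc n) f = f Fin.zero + ∑ n (λ k → f (Fin.suc k))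

  IsBlock : (ℕ → E⁺) → Set
  IsBlock X = ∀ n i j → supp (X n) i → supp (X (suc n)) j → i < j

  ⟨_⟩ : (ℕ → E⁺) → Pred E⁺ 0ℓ
  ⟨ X ⟩ v = ∃[ n ] Σ (Fin n → K) λ a → (∀ i → coeff v i ≡ ∑ n (λ k → a k * coeff (X (toℕ k)) i))

  -- V is (the nonzero part of) a linear subspace of E
  IsSubspace : Pred E⁺ 0ℓ → Set
  IsSubspace V = ∀ u w (a b : K) z → V u → V w →
                 (∀ i → coeff z i ≡ a * coeff u i + b * coeff w i) → V z

  LinIndep : (n : ℕ) → (Fin n → E⁺) → Set
  LinIndep n v = ∀ (a : Fin n → K) →
                 (∀ i → ∑ n (λ k → a k * coeff (v k) i) ≡ 0#) → ∀ k → a k ≡ 0#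

  InfDim : Pred E⁺ 0ℓ → Set
  InfDim V = ∀ n → ∃[ v ] ((∀ k → V (v k)) × LinIndep n v)

  -- a linear functional on E, given by its values φ i on the basis vectors e_i
  evalL : (ℕ → K) → List K → K
  evalL φ []      = 0#
  evalL φ (x ∷ l) = φ 0 * x + evalL (λ i → φ (suc i)) l

  -- W has finite codimension: it contains the common kernel of finitely many
  -- linear functionals
  FinCodim : Pred E⁺ 0ℓ → Set
  FinCodim W = ∃[ k ] Σ (Fin k → ℕ → K) λ φ → (∀ (v : E⁺) → (∀ (j : Fin k) → evalL (φ j) (proj₁ v) ≡ 0#) → W v)

  record IsFilter (𝓕 : Pred (Pred E⁺ 0ℓ) 0ℓ) : Set₁ where
    field
      proper  : ¬ 𝓕 (λ _ → ⊥)
      upward  : ∀ A B → 𝓕 A → A ⊆ B → 𝓕 B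
      meet    : ∀ A B → 𝓕 A → 𝓕 B → 𝓕 (λ v → A v × B v)
      cofinal : ∀ W → IsSubspace W → FinCodim W → 𝓕 W

  IsBlockFilter : Pred (Pred E⁺ 0ℓ) 0ℓ → Set₁
  IsBlockFilter 𝓕 = IsFilter 𝓕 ×
    (∀ A → 𝓕 A → ∃[ X ] (IsBlock X × 𝓕 ⟨ X ⟩ × ⟨ X ⟩ ⊆ A))

  Dense : Pred (Pred E⁺ 0ℓ) 0ℓ → Pred E⁺ 0ℓ → Set₁
  Dense 𝓕 D = ∀ X → IsBlock X → 𝓕 ⟨ X ⟩ →
              ∃[ V ] (IsSubspace V × InfDim V × V ⊆ ⟨ X ⟩ × V ⊆ D)

  Full : Pred (Pred E⁺ 0ℓ) 0ℓ → Set₁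
  Full 𝓕 = ∀ D → Dense 𝓕 D → 𝓕 D

  AsymptoticBelow : Pred E⁺ 0ℓ → (ℕ → E⁺) → Set₁
  AsymptoticBelow A X = ∀ V → IsSubspace V → InfDim V → V ⊆ ⟨ X ⟩ → ∃[ v ] (V v × A v)

  Dichotomy : Pred (Pred E⁺ 0ℓ) 0ℓ → Set₁
  Dichotomy 𝓕 = ∀ (A : Pred E⁺ 0ℓ) → ∃[ X ] (IsBlock X × 𝓕 ⟨ X ⟩ ×
                   ((∀ v → ⟨ X ⟩ v → ¬ A v) ⊎ AsymptoticBelow A X))

-- Classically, if ∁ A is not 𝓕-dense then A is asymptotic below some
-- ⟨X⟩ ∈ 𝓕. If 𝓕 is full, a dense ∁ A lies in 𝓕, and a base element
-- ⟨X⟩ ⊆ ∁ A gives the first alternative. Conversely, for an 𝓕-dense D apply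
-- the dichotomy to ∁ D: density yields an infinite-dimensional subspace of any
-- ⟨X⟩ ∈ 𝓕 inside D, so ∁ D is asymptotic below no such ⟨X⟩; hence some
-- ⟨X⟩ ∈ 𝓕 lies in D, and so does D.
module Submission where

open import Defs
open import Level using (0ℓ; suc; lift; lower)
open import Algebra.Bundles using (CommutativeRing)
open import Data.Nat using (ℕ)
open import Data.Product using (_×_; _,_; ∃-syntax)
open import Data.Sum using (_⊎_; inj₁; inj₂)
open import Relation.Binary.PropositionalEquality using (_≡_)
open import Relation.Unary using (Pred; _⊆_; ∁; _∩_; Satisfiable)
open import Relation.Nullary using (¬_; yes; no; contradiction)
open import Relation.Nullary.Decidable using (map′)
open import Function.Bundles using (_↣_; _⇔_; mk⇔)
open import Axiom.ExcludedMiddle using (ExcludedMiddle)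
open import Axiom.DoubleNegationElimination using (DoubleNegationElimination; em⇒dne)

lower-excludedMiddle : ∀ {ℓ} → ExcludedMiddle (suc ℓ) → ExcludedMiddle ℓ
lower-excludedMiddle em = map′ lower lift em

module _ (em : ExcludedMiddle (suc 0ℓ)) where

  private
    dne₁ : DoubleNegationElimination (suc 0ℓ)
    dne₁ = em⇒dne em

    dne₀ : DoubleNegationElimination 0ℓ
    dne₀ = em⇒dne (lower-excludedMiddle em)

  ¬⊆∁⇒∩-satisfiable : ∀ {A : Set} {P Q : Pred A 0ℓ} → ¬ (P ⊆ ∁ Q) → Satisfiable (P ∩ Q)
  ¬⊆∁⇒∩-satisfiable P⊈∁Q = dne₀ λ P∩Q=∅ → P⊈∁Q λ Px Qx → P∩Q=∅ (_ , Px , Qx)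

  module _ (R : CommutativeRing 0ℓ 0ℓ)
           (≈⇒≡ : ∀ {x y} → CommutativeRing._≈_ R x y → x ≡ y)
           (enc : CommutativeRing.Carrier R ↣ ℕ)
           {𝓕 : Pred (Pred (Space.E⁺ R ≈⇒≡ enc) 0ℓ) 0ℓ} where

    open Space R ≈⇒≡ enc

    ¬dense-∁⇒asymptoticBelow : ∀ {A} → ¬ Dense 𝓕 (∁ A) →
      ∃[ X ] (IsBlock X × 𝓕 ⟨ X ⟩ × AsymptoticBelow A X)
    ¬dense-∁⇒asymptoticBelow {A} ¬dense = dne₁ λ ¬asymptotic →
      ¬dense λ X block X∈𝓕 → dne₁ λ ¬avoiding →
        ¬asymptotic (X , block , X∈𝓕 , ¬avoiding⇒asymptoticBelow X ¬avoiding)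
      where
      ¬avoiding⇒asymptoticBelow : ∀ X → ¬ (∃[ V ] (IsSubspace V × InfDim V × V ⊆ ⟨ X ⟩ × V ⊆ ∁ A)) →
        AsymptoticBelow A X
      ¬avoiding⇒asymptoticBelow X ¬avoiding V subspace infDim V⊆X = ¬⊆∁⇒∩-satisfiable
        λ V⊆∁A → ¬avoiding (V , subspace , infDim , V⊆X , V⊆∁A)

    dense-∁-or-asymptoticBelow : ∀ A →
      Dense 𝓕 (∁ A) ⊎ ∃[ X ] (IsBlock X × 𝓕 ⟨ X ⟩ × AsymptoticBelow A X)
    dense-∁-or-asymptoticBelow A with em {Dense 𝓕 (∁ A)}
    ... | yes dense = inj₁ dense
    ... | no ¬dense = inj₂ (¬dense-∁⇒asymptoticBelow ¬dense)

    dense⇒¬asymptoticBelow-∁ : ∀ {D} X → Dense 𝓕 D → IsBlock X → 𝓕 ⟨ X ⟩ →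
      ¬ AsymptoticBelow (∁ D) X
    dense⇒¬asymptoticBelow-∁ X dense block X∈𝓕 asymptotic
      with dense X block X∈𝓕
    ... | V , subspace , infDim , V⊆X , V⊆D
      with asymptotic V subspace infDim V⊆X
    ... | _ , Vv , ¬Dv = contradiction (V⊆D Vv) ¬Dv

    full⇒dichotomy : (∀ A → 𝓕 A → ∃[ X ] (IsBlock X × 𝓕 ⟨ X ⟩ × ⟨ X ⟩ ⊆ A)) →
      Full 𝓕 → Dichotomy 𝓕
    full⇒dichotomy base full A with dense-∁-or-asymptoticBelow A
    ... | inj₁ dense =
      let X , block , X∈𝓕 , X⊆∁A = base _ (full _ dense)
      in X , block , X∈𝓕 , inj₁ (λ _ Xv → X⊆∁A Xv)
    ... | inj₂ (X , block , X∈𝓕 , asymptotic) = X , block , X∈𝓕 , inj₂ asymptotic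

    dichotomy⇒full : (∀ A B → 𝓕 A → A ⊆ B → 𝓕 B) → Dichotomy 𝓕 → Full 𝓕
    dichotomy⇒full upward dichotomy D dense with dichotomy (∁ D)
    ... | X , _ , X∈𝓕 , inj₁ X∩∁D=∅ = upward _ _ X∈𝓕 λ {v} Xv → dne₀ (X∩∁D=∅ v Xv)
    ... | X , block , X∈𝓕 , inj₂ asymptotic =
      contradiction asymptotic (dense⇒¬asymptoticBelow-∁ X dense block X∈𝓕)

proposition3p3 : ExcludedMiddle (suc 0ℓ) →
    (R : CommutativeRing 0ℓ 0ℓ) → IsField R →
    (≈⇒≡ : ∀ {x y} → CommutativeRing._≈_ R x y → x ≡ y) →
    (enc : CommutativeRing.Carrier R ↣ ℕ) →
    (𝓕 : Pred (Pred (Space.E⁺ R ≈⇒≡ enc) 0ℓ) 0ℓ) →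
    Space.IsBlockFilter R ≈⇒≡ enc 𝓕 →
    Space.Full R ≈⇒≡ enc 𝓕 ⇔ Space.Dichotomy R ≈⇒≡ enc 𝓕
proposition3p3 em R _ ≈⇒≡ enc 𝓕 (isFilter , base) =
  mk⇔ (full⇒dichotomy em R ≈⇒≡ enc base)
      (dichotomy⇒full em R ≈⇒≡ enc (IsFilter.upward isFilter))
  where open Space R ≈⇒≡ enc using (module IsFilter)
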